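{- Let $n\geq 0$ be an integer, let $b>4n+1$ be odd, let $A=\{1,b,b+1\}$ and let $S=(01^3)^n$ (the string $0111$ repeated $n$ times; empty if $n=0$). Then $\operatorname{per}(A,S)=2(n+1)b+1$ and $\operatorname{preper}(A,S)=0$.
   Context: For a finite nonempty set $A$ of positive integers let $\alpha=\max A$. A seed is a string $S=s_1\cdots s_\alpha\in\{0,1\}^\alpha$; a binary string of length less than $\alpha$ used as a seed is first padded on the left with $1$'s to length $\alpha$. The sequence $w^{A,S}$ is defined by $w^{A,S}(-\alpha-1+j)=s_j$ for $j=1,\ldots,\alpha$ and, for $n\geq 0$, $w^{A,S}(n)=1-\min\{w^{A,S}(n-x):x\in A\}$. The sequence $(w^{A,S}(n))_{n\ge0}$ is periodic over $p\ge1$ if there is $N\ge0$ with $w^{A,S}(m)=w^{A,S}(m+p)$ for all $m\geq N$; $\operatorname{per}(A,S)$ is the least such $p$, and $\operatorname{preper}(A,S)$ is the least $N\ge 0$ with $w^{A,S}(m)=w^{A,S}(m+\operatorname{per}(A,S))$ for all $m\geq N$. Notation: juxtaposition is concatenation of strings, $X^m$ is $m$-fold repetition. -}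

module Defs where

open import Data.Nat using (ℕ; zero; suc; _+_; _*_; _∸_; _⊔_; _≤_; _<_)
open import Data.Bool using (Bool; true; false; not; _∧_)
open import Data.List using (List; []; _∷_; _++_; length; replicate; foldr; map; concat)
open import Data.Product using (Σ; _×_; _,_; ∃)
open import Relation.Binary.PropositionalEquality using (_≡_)

-- Bits: true = 1, false = 0.  On bits, min = conjunction and 1 - b = not b.

maxL : List ℕ → ℕ
maxL = foldr _⊔_ 0

minBits : List Bool → Bool
minBits = foldr _∧_ true

-- lookup with default (never used out of range in our setting)
at : List Bool → ℕ → Bool
at []       _       = true
at (x ∷ xs) zero    = x
at (x ∷ xs) (suc k) = at xs k

padSeed : ℕ → List Bool → List Bool
padSeed α S = replicate (α ∸ length S) true ++ S

-- hist A S m : the list (w(-α), ..., w(-1), w(0), ..., w(m-1)),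
-- i.e. position i holds w(i - α).
hist : List ℕ → List Bool → ℕ → List Bool
hist A S zero    = padSeed (maxL A) S
hist A S (suc m) = hist A S m ++ (next ∷ [])
  where
  -- w(m) = 1 - min { w(m - x) : x ∈ A },  w(m - x) sits at position α + m - x
  next : Bool
  next = not (minBits (map (λ x → at (hist A S m) ((maxL A + m) ∸ x)) A))

w : List ℕ → List Bool → ℕ → Bool
w A S n = at (hist A S (suc n)) (maxL A + n)

PeriodicOver : (ℕ → Bool) → ℕ → Set
PeriodicOver u p = (1 ≤ p) × ∃ λ N → ∀ m → N ≤ m → u m ≡ u (m + p)

IsPer : (ℕ → Bool) → ℕ → Set
IsPer u p = PeriodicOver u p × (∀ q → PeriodicOver u q → p ≤ q)

IsPreper : (ℕ → Bool) → ℕ → ℕ → Set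
IsPreper u p N = (∀ m → N ≤ m → u m ≡ u (m + p))
               × (∀ N' → (∀ m → N' ≤ m → u m ≡ u (m + p)) → N ≤ N')

seed0111 : ℕ → List Bool
seed0111 n = concat (replicate n (false ∷ true ∷ true ∷ true ∷ []))

-- For A = {1, b, b+1} the rule reads w(m) = ¬ (w(m-1) ∧ w(m-b) ∧ w(m-b-1)). Cut a word into gaps
-- 0 1^(j+1); read through the rule, each gap turns into an explicit image word of the same length.
-- Write b = 4n + 2d + 1 with d ≥ 1. We give a gap list G whose word E has length 2(n+1)b + 1, and a
-- word X of length b + 1 with X images(G) = E X, i.e. images(G) is E rotated by b + 1; hence the
-- periodic word E E E … satisfies the recurrence, and since the padded seed consists of the last
-- b + 1 letters of E, w is this periodic word from position 0 on. The gap 0 1^(2d+2) occurs exactly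
-- once in G, whereas a period shorter than |E| would produce a second occurrence of it in E E.

module Submission where

open import Defs
open import Data.Nat using (ℕ; zero; suc; _+_; _*_; _∸_; _⊔_; _≤_; _<_; _<?_; _≤?_; z≤n; s≤s)
open import Data.Nat.Properties
open import Data.Nat.DivMod using (_%_; _/_; m%n<n; m<n⇒m%n≡m; [m+n]%n≡m%n; [m+kn]%n≡m%n; m≡m%n+[m/n]*n)
open import Data.Nat.Divisibility using (_∣_; divides)
open import Data.Nat.Tactic.RingSolver using (solve-∀)
open import Algebra.Properties.CommutativeSemigroup +-commutativeSemigroup using (xy∙z≈xz∙y)
open import Data.Bool using (Bool; true; false; not; _∧_)
open import Data.List using (List; []; _∷_; _++_; [_]; length; replicate; concat; concatMap; map; applyUpTo)
open import Data.List.Properties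
  using (∷-injective; length-++; length-replicate; ++-assoc; ++-identityʳ; concatMap-++; map-replicate; applyUpTo-∷ʳ)
open import Data.List.Membership.Propositional using (_∈_; _∉_)
open import Data.List.Membership.Propositional.Properties using (∈-++⁻; ∈-++⁺ʳ)
open import Data.List.Relation.Unary.Any using (here; there)
open import Data.List.Relation.Unary.All using (All; []; _∷_)
open import Data.List.Relation.Unary.All.Properties using (All¬⇒¬Any; ++⁺; replicate⁺)
open import Data.Product using (∃; ∃₂; _×_; _,_; proj₂)
open import Data.Sum using (_⊎_; inj₁; inj₂; [_,_]′)
open import Data.Empty using (⊥-elim)
open import Function using (_∘_)
open import Relation.Nullary using (¬_; yes; no)
open import Relation.Binary using (tri<; tri≈; tri>)
open import Relation.Binary.PropositionalEquality using (_≡_; _≢_; refl; sym; trans; cong; cong₂; subst; subst₂; module ≡-Reasoning)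

at-++ˡ : ∀ (xs ys : List Bool) {i} → i < length xs → at (xs ++ ys) i ≡ at xs i
at-++ˡ (x ∷ xs) ys {zero}  _          = refl
at-++ˡ (x ∷ xs) ys {suc i} (s≤s i<n) = at-++ˡ xs ys i<n

at-++ʳ : ∀ (xs ys : List Bool) i → at (xs ++ ys) (length xs + i) ≡ at ys i
at-++ʳ []       ys i = refl
at-++ʳ (x ∷ xs) ys i = at-++ʳ xs ys i

at-applyUpTo : ∀ (f : ℕ → Bool) {n i} → i < n → at (applyUpTo f n) i ≡ f i
at-applyUpTo f {suc n} {zero}  _          = refl
at-applyUpTo f {suc n} {suc i} (s≤s i<n) = at-applyUpTo (λ k → f (suc k)) i<n

applyUpTo-at : ∀ (xs : List Bool) → applyUpTo (at xs) (length xs) ≡ xs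
applyUpTo-at []       = refl
applyUpTo-at (x ∷ xs) = cong (x ∷_) (applyUpTo-at xs)

applyUpTo-cong : ∀ {f g : ℕ → Bool} n → (∀ i → i < n → f i ≡ g i) → applyUpTo f n ≡ applyUpTo g n
applyUpTo-cong zero    f≗g = refl
applyUpTo-cong (suc n) f≗g = cong₂ _∷_ (f≗g 0 (s≤s z≤n)) (applyUpTo-cong n (λ i i<n → f≗g (suc i) (s≤s i<n)))

ones : ℕ → List Bool
ones k = replicate k true

at-ones : ∀ k (L : List Bool) {i} → i < k → at (ones k ++ L) i ≡ true
at-ones (suc k) L {zero}  _          = refl
at-ones (suc k) L {suc i} (s≤s i<k) = at-ones k L i<k

at-ones-end : ∀ k (L : List Bool) → at (ones k ++ L) k ≡ at L 0
at-ones-end zero    L = refl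
at-ones-end (suc k) L = at-ones-end k L

ones-suc : ∀ k (L : List Bool) → ones (suc k) ++ L ≡ ones k ++ true ∷ L
ones-suc zero    L = refl
ones-suc (suc k) L = cong (true ∷_) (ones-suc k L)

-- Cyclic words

-- The infinite word E E E …; the lemmas below take |E| = suc p.
cyclic : List Bool → ℕ → ℕ → Bool
cyclic E p y = at E (y % suc p)

module Cyclic (E : List Bool) (p : ℕ) (|E|≡1+p : length E ≡ suc p) where

  private
    P : ℕ
    P = suc p

  cyclic-+kP : ∀ y k → cyclic E p (y + k * P) ≡ cyclic E p y
  cyclic-+kP y k = cong (at E) ([m+kn]%n≡m%n y k P)

  cyclic-+P : ∀ y → cyclic E p (y + P) ≡ cyclic E p y
  cyclic-+P y = cong (at E) ([m+n]%n≡m%n y P)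

  cyclic-+-mod : ∀ c j → cyclic E p (c + j) ≡ cyclic E p (c + j % P)
  cyclic-+-mod c j = begin
    cyclic E p (c + j)                   ≡⟨ cong (λ x → cyclic E p (c + x)) (m≡m%n+[m/n]*n j P) ⟩
    cyclic E p (c + (j % P + j / P * P)) ≡⟨ cong (cyclic E p) (+-assoc c (j % P) _) ⟨
    cyclic E p (c + j % P + j / P * P)   ≡⟨ cyclic-+kP (c + j % P) (j / P) ⟩
    cyclic E p (c + j % P)               ∎
    where open ≡-Reasoning

  private
    at-mod : ∀ {r} → r < P → at E (r % P) ≡ at E r
    at-mod r<P = cong (at E) (m<n⇒m%n≡m r<P)

  cyclic-at-++ : ∀ {y} → y < P + P → cyclic E p y ≡ at (E ++ E) y
  cyclic-at-++ {y} y<2P with y <? P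
  ... | yes y<P = trans (at-mod y<P) (sym (at-++ˡ E E (subst (y <_) (sym |E|≡1+p) y<P)))
  ... | no y≮P = subst (λ z → cyclic E p z ≡ at (E ++ E) z) P+r≡y (begin
    cyclic E p (P + r)         ≡⟨ cong (cyclic E p) (+-comm P r) ⟩
    cyclic E p (r + P)         ≡⟨ cyclic-+P r ⟩
    at E (r % P)               ≡⟨ at-mod r<P ⟩
    at E r                     ≡⟨ at-++ʳ E E r ⟨
    at (E ++ E) (length E + r) ≡⟨ cong (λ n → at (E ++ E) (n + r)) |E|≡1+p ⟩
    at (E ++ E) (P + r)        ∎)
    where
    open ≡-Reasoning
    r = y ∸ P
    P+r≡y : P + r ≡ y
    P+r≡y = m+[n∸m]≡n (≮⇒≥ y≮P)
    r<P : r < P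
    r<P = +-cancelˡ-< P r P (subst (_< P + P) (sym P+r≡y) y<2P)

suffix≡cyclic : ∀ {E} E′ W p → E ≡ E′ ++ W → length E ≡ suc p →
                W ≡ applyUpTo (λ i → cyclic E p (i + length E′)) (length W)
suffix≡cyclic {E} E′ W p refl |E|≡1+p = trans (sym (applyUpTo-at W)) (applyUpTo-cong (length W) λ i i<|W| →
  let i+K<P : i + length E′ < suc p
      i+K<P = subst (i + length E′ <_) (trans (trans (+-comm (length W) _) (sym (length-++ E′))) |E|≡1+p)
                    (+-monoˡ-< (length E′) i<|W|)
  in begin
  at W i                         ≡⟨ at-++ʳ E′ W i ⟨
  at E (length E′ + i)           ≡⟨ cong (at E) (+-comm (length E′) i) ⟩
  at E (i + length E′)           ≡⟨ cong (at E) (m<n⇒m%n≡m i+K<P) ⟨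
  cyclic E p (i + length E′)     ∎)
  where open ≡-Reasoning

-- Gap words and the recurrence

-- A word in which every 0 is followed by a 1 is the concatenation of the
-- gaps 0 1^(j+1); it is encoded by the list of the j's.
gap : ℕ → List Bool
gap j = false ∷ true ∷ ones j

gaps : List ℕ → List Bool
gaps = concatMap gap

gaps-++ : ∀ G H → gaps (G ++ H) ≡ gaps G ++ gaps H
gaps-++ = concatMap-++ gap

gaps-++-false : ∀ H z → ∃ λ z′ → gaps H ++ false ∷ z ≡ false ∷ z′
gaps-++-false []      z = z , refl
gaps-++-false (h ∷ H) z = true ∷ ones h ++ gaps H ++ false ∷ z , ++-assoc (gap h) (gaps H) (false ∷ z)

at-gaps-++-false : ∀ H z → at (gaps H ++ false ∷ z) 0 ≡ false
at-gaps-++-false H z with gaps-++-false H z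
... | _ , eq = cong (λ L → at L 0) eq

-- If s = w(b+r) and z = w(r) w(r+1) … w(r+k), then respond s z = w(b+1+r) … w(b+k+r)
-- for the recurrence with A = {1, b, b+1}.
respond : Bool → List Bool → List Bool
respond s (a ∷ c ∷ z) = not (a ∧ c ∧ s) ∷ respond (not (a ∧ c ∧ s)) (c ∷ z)
respond s _           = []

respond-at : ∀ s z {k} → suc k < length z →
             at (respond s z) k ≡ not (at z k ∧ at z (suc k) ∧ at (s ∷ respond s z) k)
respond-at s (a ∷ [])    {zero}  (s≤s ())
respond-at s (a ∷ c ∷ z) {zero}  _               = refl
respond-at s (a ∷ c ∷ z) {suc k} (s≤s k+1<|z|) = respond-at _ (c ∷ z) k+1<|z|

alternate : Bool → ℕ → List Bool
alternate s zero    = []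
alternate s (suc j) = not s ∷ alternate (not s) j

gapImage : ℕ → List Bool
gapImage j = true ∷ alternate true j ++ [ true ]

images : List ℕ → List Bool
images = concatMap gapImage

images-++ : ∀ G H → images (G ++ H) ≡ images G ++ images H
images-++ = concatMap-++ gapImage

respond-ones : ∀ s j z → respond s (true ∷ ones j ++ false ∷ z) ≡ alternate s j ++ true ∷ respond true (false ∷ z)
respond-ones s zero    z = refl
respond-ones s (suc j) z = cong (not s ∷_) (respond-ones (not s) j z)

respond-false : ∀ s z → respond s (false ∷ z) ≡ respond true (false ∷ z)
respond-false s []      = refl
respond-false s (c ∷ z) = refl

respond-gap : ∀ s j z → respond s (gap j ++ false ∷ z) ≡ gapImage j ++ respond true (false ∷ z)
respond-gap s j z = cong (true ∷_) (begin
  respond true (true ∷ ones j ++ false ∷ z)      ≡⟨ respond-ones true j z ⟩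
  alternate true j ++ true ∷ respond true (false ∷ z) ≡⟨ ++-assoc (alternate true j) [ true ] _ ⟨
  (alternate true j ++ [ true ]) ++ respond true (false ∷ z) ∎)
  where open ≡-Reasoning

respond-gaps : ∀ s H z → respond s (gaps H ++ false ∷ z) ≡ images H ++ respond true (false ∷ z)
respond-gaps s []      z = respond-false s z
respond-gaps s (h ∷ H) z with gaps-++-false H z
... | z′ , eq = begin
  respond s ((gap h ++ gaps H) ++ false ∷ z)            ≡⟨ cong (respond s) (++-assoc (gap h) (gaps H) _) ⟩
  respond s (gap h ++ gaps H ++ false ∷ z)              ≡⟨ cong (λ x → respond s (gap h ++ x)) eq ⟩
  respond s (gap h ++ false ∷ z′)                       ≡⟨ respond-gap s h z′ ⟩
  gapImage h ++ respond true (false ∷ z′)               ≡⟨ cong (λ x → gapImage h ++ respond true x) eq ⟨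
  gapImage h ++ respond true (gaps H ++ false ∷ z)      ≡⟨ cong (gapImage h ++_) (respond-gaps true H z) ⟩
  gapImage h ++ images H ++ respond true (false ∷ z)    ≡⟨ ++-assoc (gapImage h) (images H) _ ⟨
  (gapImage h ++ images H) ++ respond true (false ∷ z)  ∎
  where open ≡-Reasoning

-- For X = Y this says that images H is gaps H rotated by length X.
Shift : List Bool → List ℕ → List Bool → Set
Shift X H Y = X ++ images H ≡ gaps H ++ Y

shift-++ : ∀ {X Y Z} G H → Shift X G Y → Shift Y H Z → Shift X (G ++ H) Z
shift-++ {X} {Y} {Z} G H XGY YHZ = begin
  X ++ images (G ++ H)          ≡⟨ cong (X ++_) (images-++ G H) ⟩
  X ++ images G ++ images H     ≡⟨ ++-assoc X (images G) _ ⟨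
  (X ++ images G) ++ images H   ≡⟨ cong (_++ images H) XGY ⟩
  (gaps G ++ Y) ++ images H     ≡⟨ ++-assoc (gaps G) Y _ ⟩
  gaps G ++ Y ++ images H       ≡⟨ cong (gaps G ++_) YHZ ⟩
  gaps G ++ gaps H ++ Z         ≡⟨ ++-assoc (gaps G) (gaps H) Z ⟨
  (gaps G ++ gaps H) ++ Z       ≡⟨ cong (_++ Z) (gaps-++ G H) ⟨
  gaps (G ++ H) ++ Z            ∎
  where open ≡-Reasoning

length-gap : ∀ j → length (gap j) ≡ suc (suc j)
length-gap j = cong (λ n → suc (suc n)) (length-replicate j)

length-gaps-∷ : ∀ h H → length (gaps (h ∷ H)) ≡ suc (suc h) + length (gaps H)
length-gaps-∷ h H = trans (length-++ (gap h)) (cong (_+ length (gaps H)) (length-gap h))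

length-gaps-++ : ∀ G H → length (gaps (G ++ H)) ≡ length (gaps G) + length (gaps H)
length-gaps-++ G H = trans (cong length (gaps-++ G H)) (length-++ (gaps G))

at-++-cong : ∀ (xs : List Bool) {ys zs} {k} → k ≤ length xs → at ys 0 ≡ at zs 0 →
             at (xs ++ ys) k ≡ at (xs ++ zs) k
at-++-cong []       z≤n         eq = eq
at-++-cong (x ∷ xs) {k = zero}  _   eq = refl
at-++-cong (x ∷ xs) {k = suc k} (s≤s k≤n) eq = at-++-cong xs k≤n eq

Recurrent : ℕ → (ℕ → Bool) → Set
Recurrent b F = ∀ j → F (suc b + j) ≡ not (F j ∧ F (suc j) ∧ F (b + j))

recurrent-shift : ∀ {b} F K → Recurrent b F → Recurrent b (λ i → F (i + K))
recurrent-shift {b} F K recurrent j = begin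
  F (suc b + j + K)                          ≡⟨ cong F (+-assoc (suc b) j K) ⟩
  F (suc b + (j + K))                        ≡⟨ recurrent (j + K) ⟩
  not (F (j + K) ∧ F (suc j + K) ∧ F (b + (j + K))) ≡⟨ cong (λ x → not (F (j + K) ∧ F (suc j + K) ∧ F x)) (+-assoc b j K) ⟨
  not (F (j + K) ∧ F (suc j + K) ∧ F (b + j + K))   ∎
  where open ≡-Reasoning

++-split : ∀ (A B C D : List Bool) → A ++ B ≡ C ++ D → length A ≤ length C →
           ∃ λ M → C ≡ A ++ M × B ≡ M ++ D
++-split []      B C       D eq _         = C , refl , eq
++-split (a ∷ A) B (c ∷ C) D eq (s≤s |A|≤|C|) with ∷-injective eq
... | refl , eq′ with ++-split A B C D eq′ |A|≤|C|
... | M , C≡ , B≡ = M , cong (a ∷_) C≡ , B≡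

-- Through respond, the recurrence writes images G at distance b+1 behind gaps G; so when images G
-- is gaps G rotated by b+1, the periodic word solves the recurrence.
shift⇒recurrent : ∀ G {X} b p → Shift X G X → length X ≡ suc b → length (gaps G) ≡ suc p → b < suc p →
                  Recurrent b (cyclic (gaps G) p)
shift⇒recurrent G {X} b p shift |X|≡1+b |E|≡1+p b<P j = begin
  F (suc b + j)                                ≡⟨ F≡D (suc b) ≤-refl ⟩
  at D (suc b + r)                             ≡⟨ recurrent-D r<P ⟩
  not (at D r ∧ at D (suc r) ∧ at D (b + r))
    ≡⟨ cong₂ (λ x y → not (x ∧ y)) (F≡D 0 z≤n) (cong₂ _∧_ (F≡D 1 (s≤s z≤n)) (F≡D b (n≤1+n b))) ⟨
  not (F j ∧ F (suc j) ∧ F (b + j))            ∎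
  where
  open ≡-Reasoning
  open Cyclic (gaps G) p |E|≡1+p
  E = gaps G
  D = E ++ E
  P = suc p
  F = cyclic E p
  r = j % P
  r<P : r < P
  r<P = m%n<n j P

  F≡D : ∀ c → c ≤ suc b → F (c + j) ≡ at D (c + r)
  F≡D c c≤1+b = trans (cyclic-+-mod c j) (cyclic-at-++ (+-mono-≤-< (≤-trans c≤1+b b<P) r<P))

  rotation : ∃ λ M → E ≡ X ++ M × images G ≡ M ++ X
  rotation = ++-split X (images G) E X shift (subst₂ _≤_ (sym |X|≡1+b) (sym |E|≡1+p) b<P)

  images-rotated : ∀ {r} → r < P → at (images G) r ≡ at D (suc b + r)
  images-rotated {r} r<P with rotation
  ... | M , E≡ , images≡ = begin
    at (images G) r                  ≡⟨ cong (λ L → at L r) images≡ ⟩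
    at (M ++ X) r                    ≡⟨ at-++ˡ (M ++ X) M |M++X|>r ⟨
    at ((M ++ X) ++ M) r             ≡⟨ cong (λ L → at L r) (++-assoc M X M) ⟩
    at (M ++ X ++ M) r               ≡⟨ cong (λ L → at (M ++ L) r) E≡ ⟨
    at (M ++ E) r                    ≡⟨ at-++ʳ X (M ++ E) r ⟨
    at (X ++ M ++ E) (length X + r)  ≡⟨ cong₂ (λ w n → at w (n + r)) (++-assoc X M E) (sym |X|≡1+b) ⟨
    at ((X ++ M) ++ E) (suc b + r)   ≡⟨ cong (λ L → at (L ++ E) (suc b + r)) E≡ ⟨
    at D (suc b + r)                 ∎
    where
    |M++X|>r : r < length (M ++ X)
    |M++X|>r = subst (r <_) (sym (begin
      length (M ++ X)      ≡⟨ length-++ M ⟩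
      length M + length X  ≡⟨ +-comm (length M) _ ⟩
      length X + length M  ≡⟨ length-++ X ⟨
      length (X ++ M)      ≡⟨ cong length E≡ ⟨
      length E             ≡⟨ |E|≡1+p ⟩
      P                    ∎)) r<P

  z = E ++ [ false ]
  s = at D b

  images≡respond : respond s z ≡ images G
  images≡respond = trans (respond-gaps s G []) (++-identityʳ (images G))

  z≡D : ∀ {r} → r ≤ P → at z r ≡ at D r
  z≡D r≤P = at-++-cong E (subst (_ ≤_) (sym |E|≡1+p) r≤P)
    (sym (trans (sym (at-++ˡ E [ false ] (subst (0 <_) (sym |E|≡1+p) (s≤s z≤n)))) (at-gaps-++-false G [])))

  previous≡D : ∀ {r} → r < P → at (s ∷ respond s z) r ≡ at D (b + r)
  previous≡D {zero}   _      = cong (at D) (sym (+-identityʳ b))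
  previous≡D {suc r} r+1<P = begin
    at (respond s z) r      ≡⟨ cong (λ L → at L r) images≡respond ⟩
    at (images G) r         ≡⟨ images-rotated (<-trans (n<1+n r) r+1<P) ⟩
    at D (suc b + r)        ≡⟨ cong (at D) (+-suc b r) ⟨
    at D (b + suc r)        ∎

  recurrent-D : ∀ {r} → r < P → at D (suc b + r) ≡ not (at D r ∧ at D (suc r) ∧ at D (b + r))
  recurrent-D {r} r<P = begin
    at D (suc b + r)                                           ≡⟨ images-rotated r<P ⟨
    at (images G) r                                            ≡⟨ cong (λ L → at L r) images≡respond ⟨
    at (respond s z) r                                         ≡⟨ respond-at s z |z|>r+1 ⟩
    not (at z r ∧ at z (suc r) ∧ at (s ∷ respond s z) r)
      ≡⟨ cong₂ (λ x y → not (x ∧ y)) (z≡D (<⇒≤ r<P)) (cong₂ _∧_ (z≡D r<P) (previous≡D r<P)) ⟩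
    not (at D r ∧ at D (suc r) ∧ at D (b + r))                 ∎
    where
    |z|>r+1 : suc r < length z
    |z|>r+1 = subst (suc r <_) (sym (trans (length-++ E) (trans (cong (_+ 1) |E|≡1+p) (+-comm P 1)))) (s≤s r<P)

∧-reverse : ∀ x y z → x ∧ y ∧ z ∧ true ≡ z ∧ y ∧ x
∧-reverse false false false = refl
∧-reverse false false true  = refl
∧-reverse false true  false = refl
∧-reverse false true  true  = refl
∧-reverse true  false false = refl
∧-reverse true  false true  = refl
∧-reverse true  true  false = refl
∧-reverse true  true  true  = refl

module _ (b : ℕ) (S : List Bool) (F : ℕ → Bool) (1≤b : 1 ≤ b) (recurrent : Recurrent b F)
         (seed : padSeed (suc b) S ≡ applyUpTo F (suc b)) where

  private
    A : List ℕ
    A = 1 ∷ b ∷ b + 1 ∷ []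

    α≡1+b : maxL A ≡ suc b
    α≡1+b = begin
      1 ⊔ (b ⊔ ((b + 1) ⊔ 0))  ≡⟨ cong (λ x → 1 ⊔ (b ⊔ x)) (trans (⊔-identityʳ (b + 1)) (+-comm b 1)) ⟩
      1 ⊔ (b ⊔ suc b)          ≡⟨ cong (1 ⊔_) (m≤n⇒m⊔n≡n (n≤1+n b)) ⟩
      1 ⊔ suc b                ≡⟨ m≤n⇒m⊔n≡n (s≤s z≤n) ⟩
      suc b                    ∎
      where open ≡-Reasoning

  hist≡solution : ∀ m → hist A S m ≡ applyUpTo F (suc b + m)
  hist≡solution zero = begin
    padSeed (maxL A) S        ≡⟨ cong (λ α → padSeed α S) α≡1+b ⟩
    padSeed (suc b) S         ≡⟨ seed ⟩
    applyUpTo F (suc b)       ≡⟨ cong (applyUpTo F) (+-identityʳ (suc b)) ⟨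
    applyUpTo F (suc b + 0)   ∎
    where open ≡-Reasoning
  hist≡solution (suc m) = begin
    hist A S m ++ [ next (hist A S m) ]        ≡⟨ cong (λ h → h ++ [ next h ]) (hist≡solution m) ⟩
    applyUpTo F N ++ [ next (applyUpTo F N) ]  ≡⟨ cong (λ x → applyUpTo F N ++ [ x ]) next≡F ⟩
    applyUpTo F N ++ [ F N ]                   ≡⟨ applyUpTo-∷ʳ F N ⟩
    applyUpTo F (suc N)                        ≡⟨ cong (applyUpTo F) (+-suc (suc b) m) ⟨
    applyUpTo F (suc b + suc m)                ∎
    where
    open ≡-Reasoning
    N = suc b + m
    next : List Bool → Bool
    next h = not (minBits (map (λ x → at h ((maxL A + m) ∸ x)) A))
    F-at : ∀ x {k} → N ∸ x ≡ k → k < N → at (applyUpTo F N) ((maxL A + m) ∸ x) ≡ F k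
    F-at x refl k<N = trans (cong (λ α → at (applyUpTo F N) ((α + m) ∸ x)) α≡1+b) (at-applyUpTo F k<N)
    N∸b≡1+m : N ∸ b ≡ suc m
    N∸b≡1+m = trans (cong (_∸ b) (sym (+-suc b m))) (m+n∸m≡n b (suc m))
    N∸[b+1]≡m : N ∸ (b + 1) ≡ m
    N∸[b+1]≡m = trans (cong (N ∸_) (+-comm b 1)) (m+n∸m≡n (suc b) m)
    next≡F : next (applyUpTo F N) ≡ F N
    next≡F = begin
      next (applyUpTo F N)                       ≡⟨ cong₂ (λ x y → not (x ∧ y)) (F-at 1 refl ≤-refl)
                                                      (cong₂ (λ x y → x ∧ y ∧ true) (F-at b N∸b≡1+m (s≤s (+-monoˡ-≤ m 1≤b)))
                                                                                   (F-at (b + 1) N∸[b+1]≡m (s≤s (m≤n+m m b)))) ⟩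
      not (F (b + m) ∧ F (suc m) ∧ F m ∧ true)  ≡⟨ cong not (∧-reverse (F (b + m)) (F (suc m)) (F m)) ⟩
      not (F m ∧ F (suc m) ∧ F (b + m))         ≡⟨ recurrent m ⟨
      F N                                        ∎

  w≡solution : ∀ m → w A S m ≡ F (suc b + m)
  w≡solution m = begin
    at (hist A S (suc m)) (maxL A + m)           ≡⟨ cong₂ (λ h α → at h (α + m)) (hist≡solution (suc m)) α≡1+b ⟩
    at (applyUpTo F (suc b + suc m)) (suc b + m) ≡⟨ at-applyUpTo F (subst (suc b + m <_) (sym (+-suc (suc b) m)) ≤-refl) ⟩
    F (suc b + m)                                ∎
    where open ≡-Reasoning

-- Least periods

GapAt : List Bool → ℕ → ℕ → Set
GapAt L pos j = ∀ k → k ≤ suc (suc j) → at L (pos + k) ≡ at (gap j ++ [ false ]) k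

true≢false : true ≢ false
true≢false ()

gapAt-gaps : ∀ G j H → GapAt (gaps (G ++ j ∷ H) ++ [ false ]) (length (gaps G)) j
gapAt-gaps G j H k k≤j+2 = begin
  at (gaps (G ++ j ∷ H) ++ [ false ]) (length (gaps G) + k)  ≡⟨ cong (λ L → at L (length (gaps G) + k)) split ⟩
  at (gaps G ++ gap j ++ rest) (length (gaps G) + k)        ≡⟨ at-++ʳ (gaps G) _ k ⟩
  at (gap j ++ rest) k
    ≡⟨ at-++-cong (gap j) (subst (k ≤_) (sym (length-gap j)) k≤j+2) (at-gaps-++-false H []) ⟩
  at (gap j ++ [ false ]) k                                  ∎
  where
  open ≡-Reasoning
  rest = gaps H ++ [ false ]
  split : gaps (G ++ j ∷ H) ++ [ false ] ≡ gaps G ++ gap j ++ rest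
  split = begin
    gaps (G ++ j ∷ H) ++ [ false ]          ≡⟨ cong (_++ [ false ]) (gaps-++ G (j ∷ H)) ⟩
    (gaps G ++ gap j ++ gaps H) ++ [ false ] ≡⟨ ++-assoc (gaps G) _ [ false ] ⟩
    gaps G ++ (gap j ++ gaps H) ++ [ false ] ≡⟨ cong (gaps G ++_) (++-assoc (gap j) (gaps H) [ false ]) ⟩
    gaps G ++ gap j ++ rest                 ∎

no-gapAt-[false] : ∀ pos j → ¬ GapAt [ false ] pos j
no-gapAt-[false] zero      j gapAt = true≢false (trans (gapAt (suc (suc j)) ≤-refl) (at-ones-end j [ false ]))
no-gapAt-[false] (suc pos) j gapAt = true≢false (gapAt 0 z≤n)

gapAt-gap-++ : ∀ h L pos j → at L 0 ≡ false → GapAt (gap h ++ L) pos j →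
               (pos ≡ 0 × h ≡ j) ⊎ (suc (suc h) ≤ pos)
gapAt-gap-++ h L zero j L₀≡0 gapAt with <-cmp h j
... | tri< h<j _ _ = ⊥-elim (true≢false (begin
  true                                        ≡⟨ at-ones j [ false ] h<j ⟨
  at (gap j ++ [ false ]) (suc (suc h))       ≡⟨ gapAt (suc (suc h)) (s≤s (s≤s (<⇒≤ h<j))) ⟨
  at (gap h ++ L) (suc (suc h))               ≡⟨ at-ones-end h L ⟩
  at L 0                                      ≡⟨ L₀≡0 ⟩
  false                                       ∎))
  where open ≡-Reasoning
... | tri≈ _ h≡j _ = inj₁ (refl , h≡j)
... | tri> _ _ j<h = ⊥-elim (true≢false (begin
  true                                        ≡⟨ at-ones h L j<h ⟨
  at (gap h ++ L) (suc (suc j))               ≡⟨ gapAt (suc (suc j)) ≤-refl ⟩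
  at (gap j ++ [ false ]) (suc (suc j))       ≡⟨ at-ones-end j [ false ] ⟩
  false                                       ∎))
  where open ≡-Reasoning
gapAt-gap-++ h L (suc pos) j L₀≡0 gapAt with pos <? suc h
... | yes pos<h+1 = ⊥-elim (true≢false (begin
  true                                 ≡⟨ at-ones (suc h) L pos<h+1 ⟨
  at (true ∷ ones h ++ L) pos          ≡⟨ cong (at (true ∷ ones h ++ L)) (+-identityʳ pos) ⟨
  at (gap h ++ L) (suc pos + 0)        ≡⟨ gapAt 0 z≤n ⟩
  false                                ∎))
  where open ≡-Reasoning
... | no pos≮h+1 = inj₂ (s≤s (≮⇒≥ pos≮h+1))

gapAt-++ʳ : ∀ xs L r j → GapAt (xs ++ L) (length xs + r) j → GapAt L r j
gapAt-++ʳ xs L r j gapAt k k≤j+2 = begin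
  at L (r + k)                     ≡⟨ at-++ʳ xs L (r + k) ⟨
  at (xs ++ L) (length xs + (r + k)) ≡⟨ cong (at (xs ++ L)) (+-assoc (length xs) r k) ⟨
  at (xs ++ L) (length xs + r + k) ≡⟨ gapAt k k≤j+2 ⟩
  at (gap j ++ [ false ]) k        ∎
  where open ≡-Reasoning

gapAt⇒split : ∀ H pos j → GapAt (gaps H ++ [ false ]) pos j →
              ∃₂ λ G₁ G₂ → H ≡ G₁ ++ j ∷ G₂ × length (gaps G₁) ≡ pos
gapAt⇒split []      pos j gapAt = ⊥-elim (no-gapAt-[false] pos j gapAt)
gapAt⇒split (h ∷ H) pos j gapAt =
  split (gapAt-gap-++ h L pos j (at-gaps-++-false H []) gapAt′)
  where
  L = gaps H ++ [ false ]
  gapAt′ : GapAt (gap h ++ L) pos j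
  gapAt′ = subst (λ L′ → GapAt L′ pos j) (++-assoc (gap h) (gaps H) [ false ]) gapAt
  split : (pos ≡ 0 × h ≡ j) ⊎ (suc (suc h) ≤ pos) →
          ∃₂ λ G₁ G₂ → h ∷ H ≡ G₁ ++ j ∷ G₂ × length (gaps G₁) ≡ pos
  split (inj₁ (refl , refl)) = [] , H , refl , refl
  split (inj₂ h+2≤pos)
    with gapAt⇒split H r j (gapAt-++ʳ (gap h) L r j (subst (λ n → GapAt (gap h ++ L) n j) (sym gap+r≡pos) gapAt′))
    where
    r = pos ∸ suc (suc h)
    gap+r≡pos : length (gap h) + r ≡ pos
    gap+r≡pos = trans (cong (_+ r) (length-gap h)) (m+[n∸m]≡n h+2≤pos)
  ... | G₁ , G₂ , H≡ , |G₁|≡r = h ∷ G₁ , G₂ , cong (h ∷_) H≡ ,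
        trans (length-gaps-∷ h G₁) (trans (cong (suc (suc h) +_) |G₁|≡r) (m+[n∸m]≡n h+2≤pos))

∉-split : ∀ {x : ℕ} A {B C D} → x ∉ A → A ++ x ∷ B ≡ C ++ x ∷ D →
          C ≡ A ⊎ ∃ λ C′ → C ≡ A ++ x ∷ C′ × B ≡ C′ ++ x ∷ D
∉-split []      {C = []}    x∉A eq = inj₁ refl
∉-split []      {C = c ∷ C} x∉A eq with ∷-injective eq
... | refl , B≡ = inj₂ (C , refl , B≡)
∉-split (a ∷ A) {C = []}    x∉A eq with ∷-injective eq
... | refl , _ = ⊥-elim (x∉A (here refl))
∉-split (a ∷ A) {C = c ∷ C} x∉A eq with ∷-injective eq
... | refl , eq′ with ∉-split A (λ x∈A → x∉A (there x∈A)) eq′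
... | inj₁ C≡A = inj₁ (cong (a ∷_) C≡A)
... | inj₂ (C′ , C≡ , B≡) = inj₂ (C′ , cong (a ∷_) C≡ , B≡)

split-twice : ∀ {x : ℕ} G₁ G₂ {H₁ H₂} → x ∉ G₁ → x ∉ G₂ →
              (G₁ ++ x ∷ G₂) ++ (G₁ ++ x ∷ G₂) ≡ H₁ ++ x ∷ H₂ →
              H₁ ≡ G₁ ⊎ H₁ ≡ (G₁ ++ x ∷ G₂) ++ G₁
split-twice {x} G₁ G₂ {H₁} {H₂} x∉G₁ x∉G₂ eq
  with ∉-split G₁ x∉G₁ (trans (sym (++-assoc G₁ (x ∷ G₂) _)) eq)
... | inj₁ H₁≡G₁ = inj₁ H₁≡G₁
... | inj₂ (C′ , H₁≡ , G₂G≡)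
  with ∉-split (G₂ ++ G₁) (λ x∈ → [ x∉G₂ , x∉G₁ ]′ (∈-++⁻ G₂ x∈)) (trans (++-assoc G₂ G₁ _) G₂G≡)
... | inj₁ C′≡ = inj₂ (trans H₁≡ (trans (cong (λ C → G₁ ++ x ∷ C) C′≡) (sym (++-assoc G₁ (x ∷ G₂) G₁))))
... | inj₂ (C″ , _ , G₂≡) = ⊥-elim (x∉G₂ (subst (x ∈_) (sym G₂≡) (∈-++⁺ʳ C″ (here refl))))

-- A shorter period q would move the unique occurrence of the gap x, at s₀, to s₀ + q.
unique-gap⇒period-≥ : ∀ {x} G G₁ G₂ p (u : ℕ → Bool) → G ≡ G₁ ++ x ∷ G₂ → x ∉ G₁ → x ∉ G₂ →
  length (gaps G) ≡ suc p → (∀ m → u m ≡ cyclic (gaps G) p m) →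
  ∀ q → PeriodicOver u q → suc p ≤ q
unique-gap⇒period-≥ {x} _ G₁ G₂ p u refl x∉G₁ x∉G₂ |E|≡1+p u≡ q (1≤q , N , periodic) with suc p ≤? q
... | yes P≤q = P≤q
... | no P≰q = ⊥-elim (no-second-occurrence (gapAt⇒split (G ++ G) (s₀ + q) x shifted-gap))
  where
  open Cyclic (gaps (G₁ ++ x ∷ G₂)) p |E|≡1+p
  G = G₁ ++ x ∷ G₂
  E = gaps G
  P = suc p
  F = cyclic E p
  s₀ = length (gaps G₁)
  D = gaps (G ++ G) ++ [ false ]
  q<P : q < P
  q<P = ≰⇒> P≰q
  s₀+x+2≤P : s₀ + suc (suc x) ≤ P
  s₀+x+2≤P = subst (s₀ + suc (suc x) ≤_) |G|≡ (+-monoʳ-≤ s₀ (m≤m+n (suc (suc x)) _))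
    where
    |G|≡ : s₀ + (suc (suc x) + length (gaps G₂)) ≡ P
    |G|≡ = trans (sym (trans (length-gaps-++ G₁ (x ∷ G₂)) (cong (s₀ +_) (length-gaps-∷ x G₂)))) |E|≡1+p
  F≡D : ∀ {y} → y < P + P → F y ≡ at D y
  F≡D {y} y<2P = begin
    F y                        ≡⟨ cyclic-at-++ y<2P ⟩
    at (E ++ E) y              ≡⟨ cong (λ L → at L y) (gaps-++ G G) ⟨
    at (gaps (G ++ G)) y       ≡⟨ at-++ˡ (gaps (G ++ G)) [ false ] (subst (y <_) (sym |GG|≡) y<2P) ⟨
    at D y                     ∎
    where
    open ≡-Reasoning
    |GG|≡ : length (gaps (G ++ G)) ≡ P + P
    |GG|≡ = trans (length-gaps-++ G G) (cong₂ _+_ |E|≡1+p |E|≡1+p)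
  gap-s₀ : GapAt D s₀ x
  gap-s₀ = subst (λ H → GapAt (gaps H ++ [ false ]) s₀ x) (sym (++-assoc G₁ (x ∷ G₂) G)) (gapAt-gaps G₁ x (G₂ ++ G))
  shifted-gap : GapAt D (s₀ + q) x
  shifted-gap k k≤x+2 = begin
    at D (s₀ + q + k)          ≡⟨ F≡D (subst (_< P + P) (xy∙z≈xz∙y s₀ k q) (+-mono-≤-< y≤P q<P)) ⟨
    F (s₀ + q + k)             ≡⟨ cong F (xy∙z≈xz∙y s₀ q k) ⟩
    F (y + q)                  ≡⟨ cyclic-+kP (y + q) N ⟨
    F (y + q + N * P)          ≡⟨ cong F (xy∙z≈xz∙y y q (N * P)) ⟩
    F (y + N * P + q)          ≡⟨ u≡ (y + N * P + q) ⟨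
    u (y + N * P + q)          ≡⟨ periodic (y + N * P) N≤ ⟨
    u (y + N * P)              ≡⟨ u≡ (y + N * P) ⟩
    F (y + N * P)              ≡⟨ cyclic-+kP y N ⟩
    F y                        ≡⟨ F≡D (≤-<-trans y≤P (m<m+n P (s≤s z≤n))) ⟩
    at D (s₀ + k)              ≡⟨ gap-s₀ k k≤x+2 ⟩
    at (gap x ++ [ false ]) k  ∎
    where
    open ≡-Reasoning
    y = s₀ + k
    y≤P : y ≤ P
    y≤P = ≤-trans (+-monoʳ-≤ s₀ k≤x+2) s₀+x+2≤P
    N≤ : N ≤ y + N * P
    N≤ = ≤-trans (m≤m*n N P) (m≤n+m (N * P) y)
  no-second-occurrence : ¬ (∃₂ λ H₁ H₂ → G ++ G ≡ H₁ ++ x ∷ H₂ × length (gaps H₁) ≡ s₀ + q)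
  no-second-occurrence (H₁ , H₂ , GG≡ , |H₁|≡s₀+q) with split-twice G₁ G₂ x∉G₁ x∉G₂ GG≡
  ... | inj₁ refl = <-irrefl (sym (+-cancelˡ-≡ s₀ q 0 (trans (sym |H₁|≡s₀+q) (sym (+-identityʳ s₀))))) 1≤q
  ... | inj₂ refl = <-irrefl (+-cancelˡ-≡ s₀ q P (trans (sym |H₁|≡s₀+q) (begin
    length (gaps (G ++ G₁))       ≡⟨ length-gaps-++ G G₁ ⟩
    length E + s₀                 ≡⟨ cong (_+ s₀) |E|≡1+p ⟩
    P + s₀                        ≡⟨ +-comm P s₀ ⟩
    s₀ + P                        ∎))) q<P
    where open ≡-Reasoning

-- The period for A = {1, b, b+1} and the seed (0 1³)ⁿ

infix 8 _^_
_^_ : List Bool → ℕ → List Bool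
x ^ k = concat (replicate k x)

^-comm : ∀ x k (Z : List Bool) → x ^ k ++ x ++ Z ≡ x ++ x ^ k ++ Z
^-comm x zero    Z = refl
^-comm x (suc k) Z = begin
  (x ++ x ^ k) ++ x ++ Z  ≡⟨ ++-assoc x (x ^ k) _ ⟩
  x ++ x ^ k ++ x ++ Z    ≡⟨ cong (x ++_) (^-comm x k Z) ⟩
  x ++ x ++ x ^ k ++ Z    ≡⟨ cong (x ++_) (++-assoc x (x ^ k) Z) ⟨
  x ++ (x ++ x ^ k) ++ Z  ∎
  where open ≡-Reasoning

concatMap-replicate : ∀ (f : ℕ → List Bool) k h → concatMap f (replicate k h) ≡ f h ^ k
concatMap-replicate f k h = cong concat (map-replicate f k h)

t v u t′ v′ u′ : List Bool
t  = gap 0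
v  = gap 1
u  = gap 2
t′ = gapImage 0
v′ = gapImage 1
u′ = gapImage 2

v-u′^ : ∀ k Z → v ++ u′ ^ k ++ Z ≡ u ^ k ++ v ++ Z
v-u′^ zero    Z = refl
v-u′^ (suc k) Z = begin
  v ++ (u′ ++ u′ ^ k) ++ Z  ≡⟨ cong (v ++_) (++-assoc u′ (u′ ^ k) Z) ⟩
  u ++ v ++ u′ ^ k ++ Z     ≡⟨ cong (u ++_) (v-u′^ k Z) ⟩
  u ++ u ^ k ++ v ++ Z      ≡⟨ ++-assoc u (u ^ k) _ ⟨
  (u ++ u ^ k) ++ v ++ Z    ∎
  where open ≡-Reasoning

true-u^ : ∀ k Z → true ∷ u ^ k ++ Z ≡ u′ ^ k ++ true ∷ Z
true-u^ zero    Z = refl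
true-u^ (suc k) Z = begin
  true ∷ (u ++ u ^ k) ++ Z     ≡⟨ cong (true ∷_) (++-assoc u (u ^ k) Z) ⟩
  u′ ++ true ∷ u ^ k ++ Z      ≡⟨ cong (u′ ++_) (true-u^ k Z) ⟩
  u′ ++ u′ ^ k ++ true ∷ Z     ≡⟨ ++-assoc u′ (u′ ^ k) _ ⟨
  (u′ ++ u′ ^ k) ++ true ∷ Z   ∎
  where open ≡-Reasoning

t′^ : ∀ d → t′ ^ d ≡ ones (d * 2)
t′^ zero    = refl
t′^ (suc d) = cong (λ z → true ∷ true ∷ z) (t′^ d)

alternate-even : ∀ d → alternate true (d * 2) ≡ t ^ d
alternate-even zero    = refl
alternate-even (suc d) = cong (λ z → false ∷ true ∷ z) (alternate-even d)

alternate-odd : ∀ d → alternate true (suc (d * 2)) ≡ t ^ d ++ [ false ]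
alternate-odd zero    = refl
alternate-odd (suc d) = cong (λ z → false ∷ true ∷ z) (alternate-odd d)

gapImage-even : ∀ d Z → gapImage (d * 2) ++ Z ≡ true ∷ t ^ d ++ true ∷ Z
gapImage-even d Z = cong (true ∷_) (begin
  (alternate true (d * 2) ++ [ true ]) ++ Z  ≡⟨ cong (λ L → (L ++ [ true ]) ++ Z) (alternate-even d) ⟩
  (t ^ d ++ [ true ]) ++ Z                   ≡⟨ ++-assoc (t ^ d) [ true ] Z ⟩
  t ^ d ++ true ∷ Z                          ∎)
  where open ≡-Reasoning

gapImage-odd : ∀ d Z → gapImage (suc (d * 2)) ++ Z ≡ true ∷ t ^ d ++ t ++ Z
gapImage-odd d Z = cong (true ∷_) (begin
  (alternate true (suc (d * 2)) ++ [ true ]) ++ Z  ≡⟨ cong (λ L → (L ++ [ true ]) ++ Z) (alternate-odd d) ⟩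
  ((t ^ d ++ [ false ]) ++ [ true ]) ++ Z          ≡⟨ cong (_++ Z) (++-assoc (t ^ d) [ false ] [ true ]) ⟩
  (t ^ d ++ t) ++ Z                                ≡⟨ ++-assoc (t ^ d) t Z ⟩
  t ^ d ++ t ++ Z                                  ∎)
  where open ≡-Reasoning

v-u′^-end : ∀ k → v ++ u′ ^ k ≡ u ^ k ++ v
v-u′^-end k = trans (cong (v ++_) (sym (++-identityʳ (u′ ^ k)))) (v-u′^ k [])

wing : ℕ → ℕ → List ℕ
wing i j = replicate i 2 ++ 1 ∷ replicate j 2

concatMap-wing : ∀ (f : ℕ → List Bool) i j Z → concatMap f (wing i j) ++ Z ≡ f 2 ^ i ++ f 1 ++ f 2 ^ j ++ Z
concatMap-wing f i j Z = begin
  concatMap f (replicate i 2 ++ 1 ∷ replicate j 2) ++ Z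
    ≡⟨ cong (_++ Z) (concatMap-++ f (replicate i 2) (1 ∷ replicate j 2)) ⟩
  (concatMap f (replicate i 2) ++ f 1 ++ concatMap f (replicate j 2)) ++ Z
    ≡⟨ ++-assoc (concatMap f (replicate i 2)) _ Z ⟩
  concatMap f (replicate i 2) ++ (f 1 ++ concatMap f (replicate j 2)) ++ Z
    ≡⟨ cong (concatMap f (replicate i 2) ++_) (++-assoc (f 1) _ Z) ⟩
  concatMap f (replicate i 2) ++ f 1 ++ concatMap f (replicate j 2) ++ Z
    ≡⟨ cong₂ (λ x y → x ++ f 1 ++ y ++ Z) (concatMap-replicate f i 2) (concatMap-replicate f j 2) ⟩
  f 2 ^ i ++ f 1 ++ f 2 ^ j ++ Z
    ∎
  where open ≡-Reasoning

true-wing : ∀ i j Z → true ∷ gaps (wing i j) ++ Z ≡ images (wing i j) ++ true ∷ Z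
true-wing i j Z = begin
  true ∷ gaps (wing i j) ++ Z       ≡⟨ cong (true ∷_) (concatMap-wing gap i j Z) ⟩
  true ∷ u ^ i ++ v ++ u ^ j ++ Z   ≡⟨ true-u^ i _ ⟩
  u′ ^ i ++ v′ ++ true ∷ u ^ j ++ Z ≡⟨ cong (λ L → u′ ^ i ++ v′ ++ L) (true-u^ j Z) ⟩
  u′ ^ i ++ v′ ++ u′ ^ j ++ true ∷ Z ≡⟨ concatMap-wing gapImage i j (true ∷ Z) ⟨
  images (wing i j) ++ true ∷ Z     ∎
  where open ≡-Reasoning

state : ℕ → ℕ → ℕ → List Bool
state d i j = t ^ d ++ u ^ i ++ t ++ u′ ^ j

state-suc : ∀ d i j → state d i (suc j) ≡ t ^ d ++ gaps (wing i j) ++ v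
state-suc d i j = cong (t ^ d ++_) (begin
  u ^ i ++ v ++ v ++ u′ ^ j  ≡⟨ cong (λ L → u ^ i ++ v ++ L) (v-u′^-end j) ⟩
  u ^ i ++ v ++ u ^ j ++ v   ≡⟨ concatMap-wing gap i j v ⟨
  gaps (wing i j) ++ v       ∎)
  where open ≡-Reasoning

v-wing : ∀ i j → v ++ images (wing i j) ≡ u ^ suc i ++ t ++ u′ ^ j
v-wing i j = begin
  v ++ images (wing i j)            ≡⟨ cong (v ++_) (++-identityʳ (images (wing i j))) ⟨
  v ++ images (wing i j) ++ []      ≡⟨ cong (v ++_) (concatMap-wing gapImage i j []) ⟩
  v ++ u′ ^ i ++ v′ ++ u′ ^ j ++ [] ≡⟨ v-u′^ i _ ⟩
  u ^ i ++ u ++ t ++ u′ ^ j ++ []   ≡⟨ ^-comm u i _ ⟩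
  u ++ u ^ i ++ t ++ u′ ^ j ++ []   ≡⟨ ++-assoc u (u ^ i) _ ⟨
  u ^ suc i ++ t ++ u′ ^ j ++ []    ≡⟨ cong (λ L → u ^ suc i ++ t ++ L) (++-identityʳ (u′ ^ j)) ⟩
  u ^ suc i ++ t ++ u′ ^ j          ∎
  where open ≡-Reasoning

shift-zeros : ∀ d H R → Shift (t ^ d ++ gaps H ++ R) (replicate d 0 ++ H) (R ++ ones (d * 2) ++ images H)
shift-zeros d H R = begin
  (t ^ d ++ gaps H ++ R) ++ images (replicate d 0 ++ H)
    ≡⟨ cong ((t ^ d ++ gaps H ++ R) ++_) (images-++ (replicate d 0) H) ⟩
  (t ^ d ++ gaps H ++ R) ++ images (replicate d 0) ++ images H
    ≡⟨ cong (λ L → (t ^ d ++ gaps H ++ R) ++ L ++ images H) (trans (concatMap-replicate gapImage d 0) (t′^ d)) ⟩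
  (t ^ d ++ gaps H ++ R) ++ ones (d * 2) ++ images H
    ≡⟨ ++-assoc (t ^ d) _ _ ⟩
  t ^ d ++ (gaps H ++ R) ++ ones (d * 2) ++ images H
    ≡⟨ cong (t ^ d ++_) (++-assoc (gaps H) R _) ⟩
  t ^ d ++ gaps H ++ R ++ ones (d * 2) ++ images H
    ≡⟨ ++-assoc (t ^ d) (gaps H) _ ⟨
  (t ^ d ++ gaps H) ++ R ++ ones (d * 2) ++ images H
    ≡⟨ cong (λ L → (L ++ gaps H) ++ R ++ ones (d * 2) ++ images H) (concatMap-replicate gap d 0) ⟨
  (gaps (replicate d 0) ++ gaps H) ++ R ++ ones (d * 2) ++ images H
    ≡⟨ cong (_++ R ++ ones (d * 2) ++ images H) (gaps-++ (replicate d 0) H) ⟨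
  gaps (replicate d 0 ++ H) ++ R ++ ones (d * 2) ++ images H
    ∎
  where open ≡-Reasoning

shift-big : ∀ d i j → Shift (v ++ ones (d * 2) ++ images (wing i j)) (suc d * 2 ∷ wing i j) (state d (suc i) j)
shift-big d i j = begin
  (v ++ ones (d * 2) ++ A′) ++ gapImage (suc d * 2) ++ A′
    ≡⟨ cong (v ++_) (++-assoc (ones (d * 2)) A′ _) ⟩
  v ++ ones (d * 2) ++ A′ ++ gapImage (suc d * 2) ++ A′
    ≡⟨ cong (λ L → v ++ ones (d * 2) ++ A′ ++ L) (gapImage-even (suc d) A′) ⟩
  v ++ ones (d * 2) ++ A′ ++ true ∷ (t ++ t ^ d) ++ true ∷ A′
    ≡⟨ cong (λ L → v ++ ones (d * 2) ++ A′ ++ true ∷ L) next-state ⟩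
  v ++ ones (d * 2) ++ A′ ++ true ∷ state d (suc i) j
    ≡⟨ cong (λ L → v ++ ones (d * 2) ++ L) (true-wing i j _) ⟨
  v ++ ones (d * 2) ++ true ∷ A ++ state d (suc i) j
    ≡⟨ cong (v ++_) (ones-suc (d * 2) _) ⟨
  gap (suc d * 2) ++ A ++ state d (suc i) j
    ≡⟨ ++-assoc (gap (suc d * 2)) A _ ⟨
  gaps (suc d * 2 ∷ wing i j) ++ state d (suc i) j
    ∎
  where
  open ≡-Reasoning
  A = gaps (wing i j)
  A′ = images (wing i j)
  next-state : (t ++ t ^ d) ++ true ∷ A′ ≡ state d (suc i) j
  next-state = begin
    (t ++ t ^ d) ++ true ∷ A′  ≡⟨ ++-assoc t (t ^ d) _ ⟩
    t ++ t ^ d ++ true ∷ A′    ≡⟨ ^-comm t d _ ⟨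
    t ^ d ++ v ++ A′           ≡⟨ cong (t ^ d ++_) (v-wing i j) ⟩
    state d (suc i) j          ∎

shift-fin : ∀ d n → Shift (t ++ ones (d * 2) ++ images (replicate n 2)) (suc (d * 2) ∷ replicate n 2) (state d 0 n)
shift-fin d n = begin
  (t ++ ones (d * 2) ++ U′) ++ gapImage (suc (d * 2)) ++ U′
    ≡⟨ cong (t ++_) (++-assoc (ones (d * 2)) U′ _) ⟩
  t ++ ones (d * 2) ++ U′ ++ gapImage (suc (d * 2)) ++ U′
    ≡⟨ cong (λ L → t ++ ones (d * 2) ++ L ++ gapImage (suc (d * 2)) ++ L) (concatMap-replicate gapImage n 2) ⟩
  t ++ ones (d * 2) ++ u′ ^ n ++ gapImage (suc (d * 2)) ++ u′ ^ n
    ≡⟨ cong (λ L → t ++ ones (d * 2) ++ u′ ^ n ++ L) (gapImage-odd d (u′ ^ n)) ⟩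
  t ++ ones (d * 2) ++ u′ ^ n ++ true ∷ state d 0 n
    ≡⟨ cong (λ L → t ++ ones (d * 2) ++ L) (true-u^ n _) ⟨
  t ++ ones (d * 2) ++ true ∷ u ^ n ++ state d 0 n
    ≡⟨ cong (t ++_) (ones-suc (d * 2) _) ⟨
  gap (suc (d * 2)) ++ u ^ n ++ state d 0 n
    ≡⟨ cong (λ L → gap (suc (d * 2)) ++ L ++ state d 0 n) (concatMap-replicate gap n 2) ⟨
  gap (suc (d * 2)) ++ gaps (replicate n 2) ++ state d 0 n
    ≡⟨ ++-assoc (gap (suc (d * 2))) (gaps (replicate n 2)) _ ⟨
  gaps (suc (d * 2) ∷ replicate n 2) ++ state d 0 n
    ∎
  where
  open ≡-Reasoning
  U′ = images (replicate n 2)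

block : ℕ → ℕ → ℕ → List ℕ
block d i j = (replicate d 0 ++ wing i j) ++ suc d * 2 ∷ wing i j

blocks : ℕ → ℕ → ℕ → List ℕ
blocks d i zero    = []
blocks d i (suc k) = block d i k ++ blocks d (suc i) k

lastBlock : ℕ → ℕ → List ℕ
lastBlock d n = (replicate d 0 ++ replicate n 2) ++ suc (d * 2) ∷ replicate n 2

-- With t = 01, v = 011, u = 0111 this is the word formed by the blocks
-- t^d (u^k v u^(n-1-k)) 0 1^(2d+3) (u^k v u^(n-1-k)) for k < n, followed by t^d u^n 0 1^(2d+2) u^n.
periodGaps : ℕ → ℕ → List ℕ
periodGaps d n = blocks d 0 n ++ lastBlock d n

shift-block : ∀ d i j → Shift (state d i (suc j)) (block d i j) (state d (suc i) j)
shift-block d i j = subst (λ X → Shift X (block d i j) (state d (suc i) j)) (sym (state-suc d i j))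
  (shift-++ (replicate d 0 ++ wing i j) _ (shift-zeros d (wing i j) v) (shift-big d i j))

shift-blocks : ∀ d i k → Shift (state d i k) (blocks d i k) (state d (i + k) 0)
shift-blocks d i zero    = subst (λ m → Shift (state d i 0) [] (state d m 0)) (sym (+-identityʳ i)) (++-identityʳ _)
shift-blocks d i (suc k) = subst (λ m → Shift (state d i (suc k)) (blocks d i (suc k)) (state d m 0)) (sym (+-suc i k))
  (shift-++ (block d i k) _ (shift-block d i k) (shift-blocks d (suc i) k))

shift-lastBlock : ∀ d n → Shift (state d n 0) (lastBlock d n) (state d 0 n)
shift-lastBlock d n = subst (λ X → Shift X (lastBlock d n) (state d 0 n))
  (cong (λ L → t ^ d ++ L ++ t) (concatMap-replicate gap n 2))
  (shift-++ (replicate d 0 ++ replicate n 2) _ (shift-zeros d (replicate n 2) t) (shift-fin d n))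

shift-period : ∀ d n → Shift (state d 0 n) (periodGaps d n) (state d 0 n)
shift-period d n = shift-++ (blocks d 0 n) _ (shift-blocks d 0 n) (shift-lastBlock d n)

length-^ : ∀ x k → length (x ^ k) ≡ k * length x
length-^ x zero    = refl
length-^ x (suc k) = trans (length-++ x) (cong (length x +_) (length-^ x k))

length-gaps-replicate : ∀ k h → length (gaps (replicate k h)) ≡ k * suc (suc h)
length-gaps-replicate k h = trans (cong length (concatMap-replicate gap k h)) (trans (length-^ (gap h) k) (cong (k *_) (length-gap h)))

length-gaps-wing : ∀ i j → length (gaps (wing i j)) ≡ i * 4 + (3 + j * 4)
length-gaps-wing i j = trans (length-gaps-++ (replicate i 2) (1 ∷ replicate j 2))
  (cong₂ _+_ (length-gaps-replicate i 2) (trans (length-gaps-∷ 1 (replicate j 2)) (cong (3 +_) (length-gaps-replicate j 2))))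

length-gaps-blocks : ∀ d i k → length (gaps (blocks d i k)) ≡ k * (4 * d + 8 * (i + k) + 2)
length-gaps-blocks d i zero    = refl
length-gaps-blocks d i (suc k) = begin
  length (gaps (block d i k ++ blocks d (suc i) k))
    ≡⟨ length-gaps-++ (block d i k) _ ⟩
  length (gaps (block d i k)) + length (gaps (blocks d (suc i) k))
    ≡⟨ cong₂ _+_ length-block (length-gaps-blocks d (suc i) k) ⟩
  (d * 2 + W) + (suc (suc (suc d * 2)) + W) + k * (4 * d + 8 * (suc i + k) + 2)
    ≡⟨ arithmetic d i k ⟩
  suc k * (4 * d + 8 * (i + suc k) + 2)
    ∎
  where
  open ≡-Reasoning
  W = i * 4 + (3 + k * 4)
  length-block : length (gaps (block d i k)) ≡ (d * 2 + W) + (suc (suc (suc d * 2)) + W)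
  length-block = trans (length-gaps-++ (replicate d 0 ++ wing i k) _)
    (cong₂ _+_ (trans (length-gaps-++ (replicate d 0) (wing i k)) (cong₂ _+_ (length-gaps-replicate d 0) (length-gaps-wing i k)))
               (trans (length-gaps-∷ (suc d * 2) (wing i k)) (cong (suc (suc (suc d * 2)) +_) (length-gaps-wing i k))))
  arithmetic : ∀ d i k → (d * 2 + (i * 4 + (3 + k * 4))) + (suc (suc (suc d * 2)) + (i * 4 + (3 + k * 4))) + k * (4 * d + 8 * (suc i + k) + 2)
                         ≡ suc k * (4 * d + 8 * (i + suc k) + 2)
  arithmetic = solve-∀

length-gaps-lastBlock : ∀ d n → length (gaps (lastBlock d n)) ≡ (d * 2 + n * 4) + (suc (suc (suc (d * 2))) + n * 4)
length-gaps-lastBlock d n = trans (length-gaps-++ (replicate d 0 ++ replicate n 2) _)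
  (cong₂ _+_ (trans (length-gaps-++ (replicate d 0) (replicate n 2)) (cong₂ _+_ (length-gaps-replicate d 0) (length-gaps-replicate n 2)))
             (trans (length-gaps-∷ (suc (d * 2)) (replicate n 2)) (cong (suc (suc (suc (d * 2))) +_) (length-gaps-replicate n 2))))

length-gaps-period : ∀ d n → length (gaps (periodGaps d n)) ≡ suc (2 * (n + 1) * (4 * n + suc (d * 2)))
length-gaps-period d n = trans (length-gaps-++ (blocks d 0 n) (lastBlock d n))
  (trans (cong₂ _+_ (length-gaps-blocks d 0 n) (length-gaps-lastBlock d n)) (arithmetic d n))
  where
  arithmetic : ∀ d n → n * (4 * d + 8 * (0 + n) + 2) + ((d * 2 + n * 4) + (suc (suc (suc (d * 2))) + n * 4))
                       ≡ suc (2 * (n + 1) * (4 * n + suc (d * 2)))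
  arithmetic = solve-∀

length-state : ∀ d n → length (state d 0 n) ≡ suc (4 * n + suc (d * 2))
length-state d n = trans (length-++ (t ^ d)) (trans (cong₂ _+_ (length-^ t d) (cong (2 +_) (length-^ u′ n))) (arithmetic d n))
  where
  arithmetic : ∀ d n → d * 2 + (2 + n * 4) ≡ suc (4 * n + suc (d * 2))
  arithmetic = solve-∀

seed-padding : ∀ d n → suc (4 * n + suc (d * 2)) ∸ length (seed0111 n) ≡ suc (suc (d * 2))
seed-padding d n = begin
  suc (4 * n + suc (d * 2)) ∸ length (u ^ n)  ≡⟨ cong₂ _∸_ (sym (+-suc (4 * n) _)) (trans (length-^ u n) (*-comm n 4)) ⟩
  4 * n + suc (suc (d * 2)) ∸ 4 * n          ≡⟨ m+n∸m≡n (4 * n) _ ⟩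
  suc (suc (d * 2))                          ∎
  where open ≡-Reasoning

length-padded-seed : ∀ d n → length (padSeed (suc (4 * n + suc (d * 2))) (seed0111 n)) ≡ suc (4 * n + suc (d * 2))
length-padded-seed d n = begin
  length (ones (suc b ∸ length S) ++ S)     ≡⟨ length-++ (ones (suc b ∸ length S)) ⟩
  length (ones (suc b ∸ length S)) + length S ≡⟨ cong₂ _+_ (trans (length-replicate (suc b ∸ length S)) (seed-padding d n)) (length-^ u n) ⟩
  suc (suc (d * 2)) + n * 4                 ≡⟨ arithmetic d n ⟩
  suc b                                     ∎
  where
  open ≡-Reasoning
  b = 4 * n + suc (d * 2)
  S = seed0111 n
  arithmetic : ∀ d n → suc (suc (d * 2)) + n * 4 ≡ suc (4 * n + suc (d * 2))
  arithmetic = solve-∀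

period-suffix : ∀ d n → ∃ λ E′ → gaps (periodGaps d n) ≡ E′ ++ padSeed (suc (4 * n + suc (d * 2))) (seed0111 n)
period-suffix d n = gaps (blocks d 0 n) ++ Z ++ [ false ] , (begin
  gaps (blocks d 0 n ++ lastBlock d n)                     ≡⟨ gaps-++ (blocks d 0 n) _ ⟩
  gaps (blocks d 0 n) ++ gaps (lastBlock d n)              ≡⟨ cong (gaps (blocks d 0 n) ++_) (gaps-++ (replicate d 0 ++ replicate n 2) _) ⟩
  gaps (blocks d 0 n) ++ Z ++ false ∷ ones (suc (suc (d * 2))) ++ gaps (replicate n 2)
                                                            ≡⟨ cong (λ L → gaps (blocks d 0 n) ++ Z ++ false ∷ L) W≡pad ⟩
  gaps (blocks d 0 n) ++ Z ++ false ∷ pad                  ≡⟨ cong (gaps (blocks d 0 n) ++_) (++-assoc Z [ false ] pad) ⟨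
  gaps (blocks d 0 n) ++ (Z ++ [ false ]) ++ pad           ≡⟨ ++-assoc (gaps (blocks d 0 n)) _ pad ⟨
  (gaps (blocks d 0 n) ++ Z ++ [ false ]) ++ pad           ∎)
  where
  open ≡-Reasoning
  Z = gaps (replicate d 0 ++ replicate n 2)
  pad = padSeed (suc (4 * n + suc (d * 2))) (seed0111 n)
  W≡pad : ones (suc (suc (d * 2))) ++ gaps (replicate n 2) ≡ pad
  W≡pad = cong₂ _++_ (cong ones (sym (seed-padding d n))) (concatMap-replicate gap n 2)

module Solution (n e : ℕ) where

  d b p : ℕ
  d = suc e
  b = 4 * n + suc (d * 2)
  p = 2 * (n + 1) * b

  A : List ℕ
  A = 1 ∷ b ∷ b + 1 ∷ []

  S : List Bool
  S = seed0111 n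

  E : List Bool
  E = gaps (periodGaps d n)

  |E|≡1+p : length E ≡ suc p
  |E|≡1+p = length-gaps-period d n

  b<1+p : b < suc p
  b<1+p = s≤s (subst (b ≤_) (sym (arithmetic n b)) (m≤m+n b _))
    where
    arithmetic : ∀ n b → 2 * (n + 1) * b ≡ b + (b + 2 * n * b)
    arithmetic = solve-∀

  w≡cyclic : ∀ m → w A S m ≡ cyclic E p m
  w≡cyclic m with period-suffix d n
  ... | E′ , E≡ = begin
    w A S m                        ≡⟨ w≡solution b S F 1≤b recurrent-F seed m ⟩
    cyclic E p (suc b + m + K)     ≡⟨ cong (cyclic E p) (arithmetic (suc b) m K) ⟩
    cyclic E p (m + (K + suc b))   ≡⟨ cong (λ x → cyclic E p (m + x)) K+1+b≡1+p ⟩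
    cyclic E p (m + suc p)         ≡⟨ Cyclic.cyclic-+P E p |E|≡1+p m ⟩
    cyclic E p m                   ∎
    where
    open ≡-Reasoning
    K = length E′
    F : ℕ → Bool
    F i = cyclic E p (i + K)
    1≤b : 1 ≤ b
    1≤b = ≤-trans (s≤s z≤n) (m≤n+m (suc (d * 2)) (4 * n))
    recurrent-F : Recurrent b F
    recurrent-F = recurrent-shift (cyclic E p) K (shift⇒recurrent (periodGaps d n) b p (shift-period d n) (length-state d n) |E|≡1+p b<1+p)
    seed : padSeed (suc b) S ≡ applyUpTo F (suc b)
    seed = trans (suffix≡cyclic E′ _ p E≡ |E|≡1+p) (cong (applyUpTo F) (length-padded-seed d n))
    K+1+b≡1+p : K + suc b ≡ suc p
    K+1+b≡1+p = begin
      K + suc b                          ≡⟨ cong (K +_) (length-padded-seed d n) ⟨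
      K + length (padSeed (suc b) S)     ≡⟨ length-++ E′ ⟨
      length (E′ ++ padSeed (suc b) S)   ≡⟨ cong length E≡ ⟨
      length E                           ≡⟨ |E|≡1+p ⟩
      suc p                              ∎
    arithmetic : ∀ c m K → c + m + K ≡ m + (K + c)
    arithmetic = solve-∀

  periodic : PeriodicOver (w A S) (suc p)
  periodic = s≤s z≤n , 0 , λ m _ → trans (w≡cyclic m) (sym (trans (w≡cyclic (m + suc p)) (Cyclic.cyclic-+P E p |E|≡1+p m)))

  x : ℕ
  x = suc (d * 2)

  x∉wing : ∀ i j → All (x ≢_) (wing i j)
  x∉wing i j = ++⁺ (replicate⁺ i λ ()) ((λ ()) ∷ replicate⁺ j λ ())

  x∉blocks : ∀ i k → All (x ≢_) (blocks d i k)
  x∉blocks i zero    = []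
  x∉blocks i (suc k) = ++⁺ (++⁺ (++⁺ (replicate⁺ d λ ()) (x∉wing i k)) ((1+n≢n ∘ sym) ∷ x∉wing i k)) (x∉blocks (suc i) k)

  minimal : ∀ q → PeriodicOver (w A S) q → suc p ≤ q
  minimal = unique-gap⇒period-≥ (periodGaps d n) G₁ (replicate n 2) p (w A S)
    (sym (++-assoc (blocks d 0 n) (replicate d 0 ++ replicate n 2) _))
    (All¬⇒¬Any (++⁺ (x∉blocks 0 n) (++⁺ (replicate⁺ d λ ()) (replicate⁺ n λ ()))))
    (All¬⇒¬Any (replicate⁺ n λ ()))
    |E|≡1+p w≡cyclic
    where
    G₁ = blocks d 0 n ++ replicate d 0 ++ replicate n 2

  period : IsPer (w A S) (suc p)
  period = periodic , minimal

  preperiod : IsPreper (w A S) (suc p) 0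
  preperiod = proj₂ (proj₂ periodic) , λ _ _ → z≤n

odd⇒suc-*2 : ∀ b → ¬ 2 ∣ b → ∃ λ k → b ≡ suc (k * 2)
odd⇒suc-*2 zero          ¬2∣b = ⊥-elim (¬2∣b (divides 0 refl))
odd⇒suc-*2 (suc zero)    _    = 0 , refl
odd⇒suc-*2 (suc (suc b)) ¬2∣b with odd⇒suc-*2 b (λ { (divides q b≡) → ¬2∣b (divides (suc q) (cong (suc ∘ suc) b≡)) })
... | k , b≡ = suc k , cong (suc ∘ suc) b≡

odd-above-4n+1 : ∀ n b → 4 * n + 1 < b → ¬ 2 ∣ b → ∃ λ e → b ≡ 4 * n + suc (suc e * 2)
odd-above-4n+1 n b 4n+1<b ¬2∣b with odd⇒suc-*2 b ¬2∣b
... | k , refl = k ∸ suc (2 * n) , (begin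
  suc (k * 2)                             ≡⟨ cong (λ m → suc (m * 2)) (m+[n∸m]≡n 2n<k) ⟨
  suc ((suc (2 * n) + e) * 2)             ≡⟨ arithmetic n e ⟩
  4 * n + suc (suc e * 2)                 ∎)
  where
  open ≡-Reasoning
  e = k ∸ suc (2 * n)
  2n<k : 2 * n < k
  2n<k = *-cancelʳ-< 2 (2 * n) k (subst (_≤ k * 2) (four n) (≤-pred 4n+1<b))
    where
    four : ∀ n → 4 * n + 1 ≡ suc (2 * n * 2)
    four = solve-∀
  arithmetic : ∀ n e → suc ((suc (2 * n) + e) * 2) ≡ 4 * n + suc (suc e * 2)
  arithmetic = solve-∀

lemma6p1 : (n b : ℕ) → 4 * n + 1 < b → ¬ (2 ∣ b) →
    IsPer (w (1 ∷ b ∷ (b + 1) ∷ []) (seed0111 n)) (2 * (n + 1) * b + 1)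
    × IsPreper (w (1 ∷ b ∷ (b + 1) ∷ []) (seed0111 n)) (2 * (n + 1) * b + 1) 0
lemma6p1 n b 4n+1<b ¬2∣b with odd-above-4n+1 n b 4n+1<b ¬2∣b
... | e , refl = subst (λ P → IsPer (w A S) P × IsPreper (w A S) P 0) (+-comm 1 p) (period , preperiod)
  where open Solution n e
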